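{- Let $\mathcal S$ be a polynomially bounded simple disjunctive loop and let $\vec p\in\mathrm{cl}(\mathcal S)$. Then there is an integer $k>0$ such that $\vec p^{(k)}$ is idempotent, i.e., $\vec p^{(k)}\circ\vec p^{(k)}=\vec p^{(k)}$.
   Context: An abstract polynomial over $x_1,\dots,x_n$ is a finite set of monomials (coefficients in the Boolean semiring $\{0,1\}$); an AMP is an $n$-tuple of them; abstract composition $(\vec p\circ\vec q)[i]$ substitutes $\vec q[j]$ for $x_j$ in $\vec p[i]$. $\vec p^{(k)}$ denotes the $k$-fold composition $\vec p\circ\cdots\circ\vec p$. $\mathrm{Id}=\langle x_1,\dots,x_n\rangle$. A simple disjunctive loop (SDL) is a finite set $\mathcal S$ of AMPs, each read as a concrete map $\mathbb{N}^n\to\mathbb{N}^n$ with all coefficients $1$; it is polynomially bounded if there is an $n$-tuple $\vec b$ of polynomials in $x_1,\dots,x_n,t$ with $\vec p_t(\cdots\vec p_1(\vec x))\le\vec b(\vec x,t)$ componentwise for all $\vec x\in\mathbb{N}^n$, $t\in\mathbb{N}$, $\vec p_1,\dots,\vec p_t\in\mathcal S$. $\mathrm{cl}(\mathcal S)$ is the smallest set containing $\mathrm{Id}$ and $\mathcal S$ and closed under abstract composition. -}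

module Defs where

open import Data.Nat using (ℕ; zero; suc; _+_; _*_; _^_; _≤_; _≟_)
open import Data.Nat.Properties using () renaming (_≟_ to _≟ℕ_)
open import Data.Fin using (Fin)
open import Data.Vec using (Vec; []; _∷_; lookup; tabulate; replicate; zipWith)
open import Data.Vec.Properties using (≡-dec)
open import Data.Nat.ListAction using (sum)
open import Data.List using (List; []; _∷_; [_]; concatMap; map; foldr; deduplicate; length)
open import Data.List.Membership.Propositional using (_∈_)
open import Data.List.Relation.Unary.All using (All)
open import Data.Product using (_×_; _,_)
open import Function.Bundles using (_⇔_)
open import Relation.Binary.PropositionalEquality using (_≡_)
open import Relation.Nullary using (Dec)

Monomial : ℕ → Set
Monomial n = Vec ℕ n

_≟M_ : ∀ {n} (m m′ : Monomial n) → Dec (m ≡ m′)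
_≟M_ = ≡-dec _≟ℕ_

-- An abstract polynomial is a finite set of monomials, represented by a
-- list; two representations denote the same polynomial iff they have the
-- same members (see _≈P_).
AbsPoly : ℕ → Set
AbsPoly n = List (Monomial n)

-- An abstract multi-polynomial: an n-tuple of abstract polynomials.
AMP : ℕ → Set
AMP n = Vec (AbsPoly n) n

_≈P_ : ∀ {n} → AbsPoly n → AbsPoly n → Set
p ≈P q = ∀ m → (m ∈ p) ⇔ (m ∈ q)

_≈_ : ∀ {n} → AMP n → AMP n → Set
p ≈ q = ∀ i → lookup p i ≈P lookup q i

oneM : ∀ {n} → Monomial n
oneM = replicate _ 0

_*M_ : ∀ {n} → Monomial n → Monomial n → Monomial n
_*M_ = zipWith _+_

_*P_ : ∀ {n} → AbsPoly n → AbsPoly n → AbsPoly n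
p *P q = concatMap (λ m → map (m *M_) q) p

_^P_ : ∀ {n} → AbsPoly n → ℕ → AbsPoly n
p ^P zero  = [ oneM ]
p ^P suc k = p *P (p ^P k)

substM : ∀ {n k} → Vec ℕ k → Vec (AbsPoly n) k → AbsPoly n
substM []       []       = [ oneM ]
substM (e ∷ es) (q ∷ qs) = (q ^P e) *P substM es qs

_∘A_ : ∀ {n} → AMP n → AMP n → AMP n
p ∘A q = tabulate (λ i → concatMap (λ m → substM m q) (lookup p i))

unitM : ∀ {n} → Fin n → Monomial n
unitM i = tabulate (λ j → ind i j)
  where
  open import Data.Fin using () renaming (_≟_ to _≟F_)
  open import Relation.Nullary using (yes; no)
  ind : ∀ {n} → Fin n → Fin n → ℕ
  ind i j with i ≟F j
  ... | yes _ = 1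
  ... | no  _ = 0

IdA : ∀ {n} → AMP n
IdA = tabulate (λ i → [ unitM i ])

_^⟨_⟩ : ∀ {n} → AMP n → ℕ → AMP n
p ^⟨ zero ⟩  = IdA
p ^⟨ suc k ⟩ = p ∘A (p ^⟨ k ⟩)

evalM : ∀ {k} → Vec ℕ k → Vec ℕ k → ℕ
evalM []       []       = 1
evalM (e ∷ es) (x ∷ xs) = (x ^ e) * evalM es xs

-- sum over the *set* of monomials (duplicates in the list removed)
evalP : ∀ {n} → AbsPoly n → Vec ℕ n → ℕ
evalP p x = sum (map (λ m → evalM m x) (deduplicate _≟M_ p))

evalA : ∀ {n} → AMP n → Vec ℕ n → Vec ℕ n
evalA p x = tabulate (λ i → evalP (lookup p i) x)

evalSeq : ∀ {n} → List (AMP n) → Vec ℕ n → Vec ℕ n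
evalSeq []       x = x
evalSeq (p ∷ ps) x = evalSeq ps (evalA p x)

-- concrete polynomials over ℕ in variables x_1..x_n,t : list of
-- (coefficient, exponent vector over n+1 variables; last one is t)
Poly : ℕ → Set
Poly k = List (ℕ × Vec ℕ k)

evalPoly : ∀ {k} → Poly k → Vec ℕ k → ℕ
evalPoly b y = sum (map (λ { (c , e) → c * evalM e y }) b)

snoc : ∀ {n} → Vec ℕ n → ℕ → Vec ℕ (suc n)
snoc []       t = t ∷ []
snoc (x ∷ xs) t = x ∷ snoc xs t

SDL : ℕ → Set
SDL n = List (AMP n)

PolyBounded : ∀ {n} → SDL n → Set
PolyBounded {n} S =
  Data.Product.Σ (Vec (Poly (suc n)) n) λ b →
    ∀ (x : Vec ℕ n) (ps : List (AMP n)) → All (_∈ S) ps →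
      ∀ i → lookup (evalSeq ps x) i ≤ evalPoly (lookup b i) (snoc x (length ps))

data cl {n} (S : SDL n) : AMP n → Set where
  cl-id   : cl S IdA
  cl-base : ∀ {p} → p ∈ S → cl S p
  cl-comp : ∀ {p q} → cl S p → cl S q → cl S (p ∘A q)

Idempotent : ∀ {n} → AMP n → Set
Idempotent p = (p ∘A p) ≈ p

-- Evaluating a monomial of degree k at x = (N, …, N) gives N ^ k.  Every q ∈ cl(S) is
-- dominated, monomial by monomial, by a run of the loop of some length L, so the bounding
-- polynomial gives N ^ k ≤ C · N ^ D, with C its coefficient sum and D its degree sum; for
-- N > C + L this forces k ≤ D.  Hence all powers of p range over the finitely many AMPs built
-- from monomials of degree ≤ D, and by pigeonhole p^(a) = p^(c+1+a) for some a and c.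
-- Abstract composition is associative, so p^(a) ∘ p^(b) = p^(a+b), and any multiple k ≥ a of
-- the period c + 1 satisfies p^(k) ∘ p^(k) = p^(k+k) = p^(k).

module Submission where

open import Defs
open import Algebra.Bundles using (CommutativeMonoid)
open import Algebra.Structures.Biased using (isCommutativeMonoidˡ)
import Algebra.Properties.CommutativeSemigroup as CommutativeSemigroupProperties
open import Data.Fin using (Fin; zero; suc; toℕ; combine)
open import Data.Fin.Properties using (_≟_; combine-injective; pigeonhole)
open import Data.List
  using (List; []; _∷_; [_]; _++_; concatMap; map; length; upTo; cartesianProductWith)
open import Data.List.Properties using (++-identityʳ)
open import Data.List.Membership.Propositional using (_∈_; find; lose)
open import Data.List.Membership.Propositional.Properties
  using ( ∈-concatMap⁺; ∈-concatMap⁻; ∈-map⁺; ∈-map⁻; ∈-deduplicate⁺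
        ; ∈-cartesianProductWith⁺; ∈-upTo⁺)
open import Data.List.Relation.Binary.Subset.Propositional using (_⊆_)
open import Data.List.Relation.Unary.All using (All; []; _∷_)
import Data.List.Relation.Unary.All.Properties as All
open import Data.List.Relation.Unary.Any using (here; there)
open import Data.Nat using (ℕ; zero; suc; _+_; _*_; _^_; _≤_; _<_; _>_; z≤n; s≤s)
open import Data.Nat.ListAction using (sum)
import Data.Nat.Properties as ℕ
open import Data.Nat.Tactic.RingSolver using (solve-∀)
open import Data.Product using (Σ; ∃; ∃₂; _×_; _,_; proj₁)
open import Data.Vec using (Vec; []; _∷_; lookup; replicate; tabulate)
import Data.Vec as Vec
import Data.Vec.Properties as Vecₚ
open import Function.Base using (_∘_; _∋_)
open import Function.Bundles using (Equivalence; mk⇔)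
import Function.Properties.Equivalence as ⇔
open import Relation.Binary.Bundles using (Setoid)
open import Relation.Binary.Structures using (IsEquivalence)
open import Relation.Binary.PropositionalEquality
  using (_≡_; _≢_; refl; sym; trans; cong; cong₂; subst; module ≡-Reasoning)
import Relation.Binary.Reasoning.Setoid as SetoidReasoning
open import Relation.Nullary using (yes; no; contradiction)

private
  variable
    n d : ℕ

  module ℕ* = CommutativeSemigroupProperties ℕ.*-commutativeSemigroup

-- The commutative monoid of abstract polynomials

*M-assoc : (a b c : Monomial n) → (a *M b) *M c ≡ a *M (b *M c)
*M-assoc = Vecₚ.zipWith-assoc ℕ.+-assoc

*M-comm : (a b : Monomial n) → a *M b ≡ b *M a
*M-comm = Vecₚ.zipWith-comm ℕ.+-comm

*M-identityˡ : (a : Monomial n) → oneM *M a ≡ a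
*M-identityˡ = Vecₚ.zipWith-identityˡ ℕ.+-identityˡ

≈P-refl : {P : AbsPoly n} → P ≈P P
≈P-refl _ = ⇔.refl

≈P-sym : {P Q : AbsPoly n} → P ≈P Q → Q ≈P P
≈P-sym P≈Q m = ⇔.sym (P≈Q m)

≈P-trans : {P Q R : AbsPoly n} → P ≈P Q → Q ≈P R → P ≈P R
≈P-trans P≈Q Q≈R m = ⇔.trans (P≈Q m) (Q≈R m)

≈P-reflexive : {P Q : AbsPoly n} → P ≡ Q → P ≈P Q
≈P-reflexive refl = ≈P-refl

≈P-isEquivalence : IsEquivalence (_≈P_ {n})
≈P-isEquivalence = record { refl = ≈P-refl ; sym = ≈P-sym ; trans = ≈P-trans }

≈P-setoid : ℕ → Setoid _ _
≈P-setoid n = record { isEquivalence = ≈P-isEquivalence {n} }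

private
  module ≈P-Reasoning {n} = SetoidReasoning (≈P-setoid n)

⊆⊇⇒≈P : {P Q : AbsPoly n} → P ⊆ Q → Q ⊆ P → P ≈P Q
⊆⊇⇒≈P P⊆Q Q⊆P _ = mk⇔ P⊆Q Q⊆P

≈P⇒⊆ : {P Q : AbsPoly n} → P ≈P Q → P ⊆ Q
≈P⇒⊆ P≈Q = Equivalence.to (P≈Q _)

∈-*P⁺ : {P Q : AbsPoly n} {a b : Monomial n} → a ∈ P → b ∈ Q → a *M b ∈ P *P Q
∈-*P⁺ a∈P b∈Q = ∈-concatMap⁺ _ (lose a∈P (∈-map⁺ _ b∈Q))

∈-*P⁻ : (P Q : AbsPoly n) {m : Monomial n} → m ∈ P *P Q →
        ∃₂ λ a b → a ∈ P × b ∈ Q × m ≡ a *M b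
∈-*P⁻ P Q m∈P*Q with find (∈-concatMap⁻ _ m∈P*Q)
... | a , a∈P , m∈aQ with ∈-map⁻ _ m∈aQ
...   | b , b∈Q , m≡ab = a , b , a∈P , b∈Q , m≡ab

*P-mono : {P P′ Q Q′ : AbsPoly n} → P ⊆ P′ → Q ⊆ Q′ → P *P Q ⊆ P′ *P Q′
*P-mono {P = P} {Q = Q} P⊆P′ Q⊆Q′ m∈P*Q with ∈-*P⁻ P Q m∈P*Q
... | a , b , a∈P , b∈Q , refl = ∈-*P⁺ (P⊆P′ a∈P) (Q⊆Q′ b∈Q)

*P-cong : {P P′ Q Q′ : AbsPoly n} → P ≈P P′ → Q ≈P Q′ → (P *P Q) ≈P (P′ *P Q′)
*P-cong P≈P′ Q≈Q′ = ⊆⊇⇒≈P (*P-mono (≈P⇒⊆ P≈P′) (≈P⇒⊆ Q≈Q′))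
                          (*P-mono (≈P⇒⊆ (≈P-sym P≈P′)) (≈P⇒⊆ (≈P-sym Q≈Q′)))

*P-comm⊆ : (P Q : AbsPoly n) → P *P Q ⊆ Q *P P
*P-comm⊆ P Q m∈P*Q with ∈-*P⁻ P Q m∈P*Q
... | a , b , a∈P , b∈Q , refl = subst (_∈ Q *P P) (*M-comm b a) (∈-*P⁺ b∈Q a∈P)

*P-assoc : (P Q R : AbsPoly n) → ((P *P Q) *P R) ≈P (P *P (Q *P R))
*P-assoc P Q R = ⊆⊇⇒≈P to from
  where
  to : (P *P Q) *P R ⊆ P *P (Q *P R)
  to m∈ with ∈-*P⁻ (P *P Q) R m∈
  ... | ab , c , ab∈ , c∈R , refl with ∈-*P⁻ P Q ab∈
  ...   | a , b , a∈P , b∈Q , refl =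
    subst (_∈ P *P (Q *P R)) (sym (*M-assoc a b c)) (∈-*P⁺ a∈P (∈-*P⁺ b∈Q c∈R))
  from : P *P (Q *P R) ⊆ (P *P Q) *P R
  from m∈ with ∈-*P⁻ P (Q *P R) m∈
  ... | a , bc , a∈P , bc∈ , refl with ∈-*P⁻ Q R bc∈
  ...   | b , c , b∈Q , c∈R , refl =
    subst (_∈ (P *P Q) *P R) (*M-assoc a b c) (∈-*P⁺ (∈-*P⁺ a∈P b∈Q) c∈R)

*P-identityˡ : (P : AbsPoly n) → ([ oneM ] *P P) ≈P P
*P-identityˡ P = ⊆⊇⇒≈P to from
  where
  to : [ oneM ] *P P ⊆ P
  to m∈ with ∈-*P⁻ [ oneM ] P m∈
  ... | _ , b , here refl , b∈P , refl = subst (_∈ P) (sym (*M-identityˡ b)) b∈P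
  from : P ⊆ [ oneM ] *P P
  from {m} m∈P = subst (_∈ [ oneM ] *P P) (*M-identityˡ m) (∈-*P⁺ {P = [ oneM ]} (here refl) m∈P)

*P-commutativeMonoid : ℕ → CommutativeMonoid _ _
*P-commutativeMonoid n = record
  { _≈_ = _≈P_ {n}
  ; _∙_ = _*P_
  ; ε   = [ oneM ]
  ; isCommutativeMonoid = isCommutativeMonoidˡ record
    { isSemigroup = record
      { isMagma = record { isEquivalence = ≈P-isEquivalence ; ∙-cong = *P-cong }
      ; assoc   = *P-assoc
      }
    ; identityˡ = *P-identityˡ
    ; comm      = λ P Q → ⊆⊇⇒≈P (*P-comm⊆ P Q) (*P-comm⊆ Q P)
    }
  }

private
  module PolyMonoid {n} = CommutativeMonoid (*P-commutativeMonoid n)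
  module PolyMonoidProperties {n} =
    CommutativeSemigroupProperties (PolyMonoid.commutativeSemigroup {n})

^P-mono : {P Q : AbsPoly n} → P ⊆ Q → ∀ e → (P ^P e) ⊆ (Q ^P e)
^P-mono P⊆Q zero    = λ m∈ → m∈
^P-mono P⊆Q (suc e) = *P-mono P⊆Q (^P-mono P⊆Q e)

^P-cong : {P Q : AbsPoly n} → P ≈P Q → ∀ e → (P ^P e) ≈P (Q ^P e)
^P-cong P≈Q e = ⊆⊇⇒≈P (^P-mono (≈P⇒⊆ P≈Q) e) (^P-mono (≈P⇒⊆ (≈P-sym P≈Q)) e)

^P-+ : (P : AbsPoly n) (a b : ℕ) → (P ^P (a + b)) ≈P ((P ^P a) *P (P ^P b))
^P-+ P zero    b = ≈P-sym (*P-identityˡ (P ^P b))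
^P-+ P (suc a) b = begin
  P *P (P ^P (a + b))          ≈⟨ *P-cong (≈P-refl {P = P}) (^P-+ P a b) ⟩
  P *P ((P ^P a) *P (P ^P b))  ≈⟨ ≈P-sym (*P-assoc P (P ^P a) (P ^P b)) ⟩
  (P *P (P ^P a)) *P (P ^P b)  ∎
  where open ≈P-Reasoning

-- Substitution and abstract composition

substP : AbsPoly n → AMP n → AbsPoly n
substP P r = concatMap (λ m → substM m r) P

lookup-IdA : (i : Fin n) → lookup IdA i ≡ [ unitM i ]
lookup-IdA = Vecₚ.lookup∘tabulate (λ i → [ unitM i ])

lookup-∘A : (p q : AMP n) (i : Fin n) → lookup (p ∘A q) i ≡ substP (lookup p i) q
lookup-∘A p q = Vecₚ.lookup∘tabulate (λ i → substP (lookup p i) q)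

∈-substP⁺ : {P : AbsPoly n} {r : AMP n} {a m : Monomial n} →
            a ∈ P → m ∈ substM a r → m ∈ substP P r
∈-substP⁺ a∈P m∈ = ∈-concatMap⁺ _ (lose a∈P m∈)

∈-substP⁻ : (P : AbsPoly n) (r : AMP n) {m : Monomial n} →
            m ∈ substP P r → ∃ λ a → a ∈ P × m ∈ substM a r
∈-substP⁻ P r m∈ = find (∈-concatMap⁻ _ m∈)

substM-mono : {r r′ : Vec (AbsPoly n) d} → (∀ j → lookup r j ⊆ lookup r′ j) →
              ∀ e → substM e r ⊆ substM e r′
substM-mono {r = []}    {[]}      r⊆r′ []       = λ m∈ → m∈
substM-mono {r = _ ∷ _} {_ ∷ _} r⊆r′ (e ∷ es) =
  *P-mono (^P-mono (r⊆r′ zero) e) (substM-mono (λ j → r⊆r′ (suc j)) es)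

substP-monoʳ : (P : AbsPoly n) {r r′ : AMP n} →
               (∀ j → lookup r j ⊆ lookup r′ j) → substP P r ⊆ substP P r′
substP-monoʳ P {r} r⊆r′ m∈ with ∈-substP⁻ P r m∈
... | a , a∈P , m∈ra = ∈-substP⁺ a∈P (substM-mono r⊆r′ a m∈ra)

substP-congʳ : (P : AbsPoly n) {r r′ : AMP n} → r ≈ r′ → substP P r ≈P substP P r′
substP-congʳ P r≈r′ = ⊆⊇⇒≈P (substP-monoʳ P (λ j → ≈P⇒⊆ (r≈r′ j)))
                            (substP-monoʳ P (λ j → ≈P⇒⊆ (≈P-sym (r≈r′ j))))

substM-zeros : (r : Vec (AbsPoly n) d) → substM (replicate d 0) r ≈P [ oneM ]
substM-zeros []      = ≈P-refl
substM-zeros (q ∷ r) = ≈P-trans (*P-identityˡ (substM (replicate _ 0) r)) (substM-zeros r)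

substM-*M : (a b : Vec ℕ d) (r : Vec (AbsPoly n) d) →
            substM (a *M b) r ≈P (substM a r *P substM b r)
substM-*M []       []       []      = ≈P-sym (*P-identityˡ [ oneM ])
substM-*M (a ∷ as) (b ∷ bs) (q ∷ r) = begin
  (q ^P (a + b)) *P substM (as *M bs) r
    ≈⟨ *P-cong (^P-+ q a b) (substM-*M as bs r) ⟩
  ((q ^P a) *P (q ^P b)) *P (substM as r *P substM bs r)
    ≈⟨ PolyMonoidProperties.interchange (q ^P a) (q ^P b) (substM as r) (substM bs r) ⟩
  ((q ^P a) *P substM as r) *P ((q ^P b) *P substM bs r) ∎
  where open ≈P-Reasoning

unitVec : Fin d → Vec ℕ d
unitVec zero    = 1 ∷ replicate _ 0
unitVec (suc i) = 0 ∷ unitVec i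

substM-unitVec : (i : Fin d) (r : Vec (AbsPoly n) d) → substM (unitVec i) r ≈P lookup r i
substM-unitVec zero (q ∷ r) = begin
  (q *P [ oneM ]) *P substM (replicate _ 0) r
    ≈⟨ *P-cong (PolyMonoid.identityʳ q) (substM-zeros r) ⟩
  q *P [ oneM ]
    ≈⟨ PolyMonoid.identityʳ q ⟩
  q ∎
  where open ≈P-Reasoning
substM-unitVec (suc i) (q ∷ r) =
  ≈P-trans (*P-identityˡ (substM (unitVec i) r)) (substM-unitVec i r)

lookup-unitVec-diag : (i : Fin d) → lookup (unitVec i) i ≡ 1
lookup-unitVec-diag zero    = refl
lookup-unitVec-diag (suc i) = lookup-unitVec-diag i

lookup-unitVec-offdiag : (i j : Fin d) → i ≢ j → lookup (unitVec i) j ≡ 0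
lookup-unitVec-offdiag zero    zero    i≢j = contradiction refl i≢j
lookup-unitVec-offdiag zero    (suc j) _   = Vecₚ.lookup-replicate j 0
lookup-unitVec-offdiag (suc i) zero    _   = refl
lookup-unitVec-offdiag (suc i) (suc j) i≢j = lookup-unitVec-offdiag i j (i≢j ∘ cong suc)

unitM≡unitVec : (i : Fin n) → unitM i ≡ unitVec i
unitM≡unitVec i = begin
  unitM i                          ≡⟨ Vecₚ.tabulate∘lookup (unitM i) ⟨
  tabulate (lookup (unitM i))      ≡⟨ Vecₚ.tabulate-cong lookup-unitM ⟩
  tabulate (lookup (unitVec i))    ≡⟨ Vecₚ.tabulate∘lookup (unitVec i) ⟩
  unitVec i                        ∎
  where
  lookup-unitM : ∀ j → lookup (unitM i) j ≡ lookup (unitVec i) j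
  lookup-unitM j rewrite (lookup (unitM i) j ≡ _ ∋ Vecₚ.lookup∘tabulate _ j) with i ≟ j
  ... | yes refl = sym (lookup-unitVec-diag i)
  ... | no  i≢j  = sym (lookup-unitVec-offdiag i j i≢j)
  open ≡-Reasoning

substP-singleton : (a : Monomial n) (r : AMP n) → substP [ a ] r ≈P substM a r
substP-singleton a r = ≈P-reflexive (++-identityʳ (substM a r))

substP-one : (r : AMP n) → substP [ oneM ] r ≈P [ oneM ]
substP-one r = ≈P-trans (substP-singleton oneM r) (substM-zeros r)

substP-*P : (P Q : AbsPoly n) (r : AMP n) →
            substP (P *P Q) r ≈P (substP P r *P substP Q r)
substP-*P P Q r = ⊆⊇⇒≈P to from
  where
  to : substP (P *P Q) r ⊆ (substP P r *P substP Q r)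
  to m∈ with ∈-substP⁻ (P *P Q) r m∈
  ... | ab , ab∈ , m∈rab with ∈-*P⁻ P Q ab∈
  ...   | a , b , a∈P , b∈Q , refl
          with ∈-*P⁻ (substM a r) (substM b r) (≈P⇒⊆ (substM-*M a b r) m∈rab)
  ...     | u , v , u∈ra , v∈rb , refl = ∈-*P⁺ (∈-substP⁺ a∈P u∈ra) (∈-substP⁺ b∈Q v∈rb)
  from : (substP P r *P substP Q r) ⊆ substP (P *P Q) r
  from m∈ with ∈-*P⁻ (substP P r) (substP Q r) m∈
  ... | u , v , u∈ , v∈ , refl with ∈-substP⁻ P r u∈ | ∈-substP⁻ Q r v∈
  ...   | a , a∈P , u∈ra | b , b∈Q , v∈rb =
    ∈-substP⁺ (∈-*P⁺ a∈P b∈Q) (≈P⇒⊆ (≈P-sym (substM-*M a b r)) (∈-*P⁺ u∈ra v∈rb))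

substP-^P : (P : AbsPoly n) (r : AMP n) (e : ℕ) → substP (P ^P e) r ≈P (substP P r ^P e)
substP-^P P r zero    = substP-one r
substP-^P P r (suc e) = ≈P-trans (substP-*P P (P ^P e) r)
                                 (*P-cong (≈P-refl {P = substP P r}) (substP-^P P r e))

substM-substP : {q q′ : Vec (AbsPoly n) d} (r : AMP n) →
                (∀ j → lookup q′ j ≈P substP (lookup q j) r) →
                ∀ e → substM e q′ ≈P substP (substM e q) r
substM-substP {q = []}    {[]}      r _ [] = ≈P-sym (substP-one r)
substM-substP {q = q ∷ qs} {q′ ∷ qs′} r q′≈qr (e ∷ es) = begin
  (q′ ^P e) *P substM es qs′
    ≈⟨ *P-cong (^P-cong (q′≈qr zero) e) (substM-substP r (λ j → q′≈qr (suc j)) es) ⟩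
  (substP q r ^P e) *P substP (substM es qs) r
    ≈⟨ *P-cong (≈P-sym (substP-^P q r e)) (≈P-refl {P = substP (substM es qs) r}) ⟩
  substP (q ^P e) r *P substP (substM es qs) r
    ≈⟨ ≈P-sym (substP-*P (q ^P e) (substM es qs) r) ⟩
  substP ((q ^P e) *P substM es qs) r ∎
  where open ≈P-Reasoning

substP-substP : (P : AbsPoly n) (q r : AMP n) → substP (substP P q) r ≈P substP P (q ∘A r)
substP-substP P q r = ⊆⊇⇒≈P to from
  where
  substM-∘A : ∀ a → substM a (q ∘A r) ≈P substP (substM a q) r
  substM-∘A = substM-substP r (λ j → ≈P-reflexive (lookup-∘A q r j))
  to : substP (substP P q) r ⊆ substP P (q ∘A r)
  to m∈ with ∈-substP⁻ (substP P q) r m∈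
  ... | u , u∈ , m∈ru with ∈-substP⁻ P q u∈
  ...   | a , a∈P , u∈qa = ∈-substP⁺ a∈P (≈P⇒⊆ (≈P-sym (substM-∘A a)) (∈-substP⁺ u∈qa m∈ru))
  from : substP P (q ∘A r) ⊆ substP (substP P q) r
  from m∈ with ∈-substP⁻ P (q ∘A r) m∈
  ... | a , a∈P , m∈ with ∈-substP⁻ (substM a q) r (≈P⇒⊆ (substM-∘A a) m∈)
  ...   | u , u∈qa , m∈ru = ∈-substP⁺ (∈-substP⁺ a∈P u∈qa) m∈ru

≈-isEquivalence : IsEquivalence (_≈_ {n})
≈-isEquivalence = record
  { refl  = λ _ → ≈P-refl
  ; sym   = λ p≈q i → ≈P-sym (p≈q i)
  ; trans = λ p≈q q≈r i → ≈P-trans (p≈q i) (q≈r i)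
  }

≈-setoid : ℕ → Setoid _ _
≈-setoid n = record { isEquivalence = ≈-isEquivalence {n} }

private
  module ≈-Reasoning {n} = SetoidReasoning (≈-setoid n)

∘A-congʳ : (p : AMP n) {q q′ : AMP n} → q ≈ q′ → (p ∘A q) ≈ (p ∘A q′)
∘A-congʳ p {q} {q′} q≈q′ i = begin
  lookup (p ∘A q) i       ≡⟨ lookup-∘A p q i ⟩
  substP (lookup p i) q   ≈⟨ substP-congʳ (lookup p i) q≈q′ ⟩
  substP (lookup p i) q′  ≡⟨ lookup-∘A p q′ i ⟨
  lookup (p ∘A q′) i      ∎
  where open ≈P-Reasoning

∘A-assoc : (p q r : AMP n) → ((p ∘A q) ∘A r) ≈ (p ∘A (q ∘A r))
∘A-assoc p q r i = begin
  lookup ((p ∘A q) ∘A r) i            ≡⟨ lookup-∘A (p ∘A q) r i ⟩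
  substP (lookup (p ∘A q) i) r        ≡⟨ cong (λ P → substP P r) (lookup-∘A p q i) ⟩
  substP (substP (lookup p i) q) r    ≈⟨ substP-substP (lookup p i) q r ⟩
  substP (lookup p i) (q ∘A r)        ≡⟨ lookup-∘A p (q ∘A r) i ⟨
  lookup (p ∘A (q ∘A r)) i            ∎
  where open ≈P-Reasoning

∘A-identityˡ : (q : AMP n) → (IdA ∘A q) ≈ q
∘A-identityˡ q i = begin
  lookup (IdA ∘A q) i           ≡⟨ lookup-∘A IdA q i ⟩
  substP (lookup IdA i) q       ≡⟨ cong (λ P → substP P q) (lookup-IdA i) ⟩
  substP [ unitM i ] q          ≈⟨ substP-singleton (unitM i) q ⟩
  substM (unitM i) q            ≡⟨ cong (λ e → substM e q) (unitM≡unitVec i) ⟩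
  substM (unitVec i) q          ≈⟨ substM-unitVec i q ⟩
  lookup q i                    ∎
  where open ≈P-Reasoning

^⟨⟩-+ : (p : AMP n) (a b : ℕ) → ((p ^⟨ a ⟩) ∘A (p ^⟨ b ⟩)) ≈ (p ^⟨ a + b ⟩)
^⟨⟩-+ p zero    b = ∘A-identityˡ (p ^⟨ b ⟩)
^⟨⟩-+ p (suc a) b = begin
  (p ∘A (p ^⟨ a ⟩)) ∘A (p ^⟨ b ⟩)  ≈⟨ ∘A-assoc p (p ^⟨ a ⟩) (p ^⟨ b ⟩) ⟩
  p ∘A ((p ^⟨ a ⟩) ∘A (p ^⟨ b ⟩))  ≈⟨ ∘A-congʳ p {q′ = p ^⟨ a + b ⟩} (^⟨⟩-+ p a b) ⟩
  p ∘A (p ^⟨ a + b ⟩)              ∎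
  where open ≈-Reasoning

^⟨⟩-shift : (p : AMP n) {a b : ℕ} → (p ^⟨ a ⟩) ≈ (p ^⟨ b ⟩) →
            ∀ t → (p ^⟨ t + a ⟩) ≈ (p ^⟨ t + b ⟩)
^⟨⟩-shift p pᵃ≈pᵇ zero    = pᵃ≈pᵇ
^⟨⟩-shift p {a} {b} pᵃ≈pᵇ (suc t) =
  ∘A-congʳ p {p ^⟨ t + a ⟩} {p ^⟨ t + b ⟩} (^⟨⟩-shift p pᵃ≈pᵇ t)

EventuallyPeriodic : AMP n → Set
EventuallyPeriodic p = ∃₂ λ a c → (p ^⟨ a ⟩) ≈ (p ^⟨ suc c + a ⟩)

module _ (p : AMP n) {a c : ℕ} (periodic : (p ^⟨ a ⟩) ≈ (p ^⟨ suc c + a ⟩)) where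

  ^⟨⟩-periodic : ∀ q m → (p ^⟨ q * suc c + (m + a) ⟩) ≈ (p ^⟨ m + a ⟩)
  ^⟨⟩-periodic zero    m = λ _ → ≈P-refl
  ^⟨⟩-periodic (suc q) m = begin
    p ^⟨ (suc c + q * suc c) + (m + a) ⟩  ≡⟨ cong (p ^⟨_⟩) (regroup (suc c) (q * suc c) m a) ⟩
    p ^⟨ (q * suc c + m) + (suc c + a) ⟩  ≈⟨ ^⟨⟩-shift p periodic (q * suc c + m) ⟨
    p ^⟨ (q * suc c + m) + a ⟩            ≡⟨ cong (p ^⟨_⟩) (ℕ.+-assoc (q * suc c) m a) ⟩
    p ^⟨ q * suc c + (m + a) ⟩            ≈⟨ ^⟨⟩-periodic q m ⟩
    p ^⟨ m + a ⟩                          ∎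
    where
    open ≈-Reasoning
    regroup : ∀ x y z w → (x + y) + (z + w) ≡ (y + z) + (x + w)
    regroup = solve-∀

  idempotent-^⟨⟩ : Idempotent (p ^⟨ suc a * suc c ⟩)
  idempotent-^⟨⟩ = begin
    (p ^⟨ k ⟩) ∘A (p ^⟨ k ⟩)   ≈⟨ ^⟨⟩-+ p k k ⟩
    p ^⟨ k + k ⟩               ≡⟨ cong (λ x → p ^⟨ k + x ⟩) k≡m+a ⟩
    p ^⟨ k + (m + a) ⟩         ≈⟨ ^⟨⟩-periodic (suc a) m ⟩
    p ^⟨ m + a ⟩               ≡⟨ cong (p ^⟨_⟩) k≡m+a ⟨
    p ^⟨ k ⟩                   ∎
    where
    open ≈-Reasoning
    k = suc a * suc c
    m = suc c + a * c
    k≡m+a : k ≡ m + a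
    k≡m+a = split a c
      where
      split : ∀ a c → suc a * suc c ≡ (suc c + a * c) + a
      split = solve-∀

-- Concrete evaluation

evalM-zeros : (x : Vec ℕ d) → evalM (replicate d 0) x ≡ 1
evalM-zeros []       = refl
evalM-zeros (x ∷ xs) = trans (ℕ.+-identityʳ (evalM (replicate _ 0) xs)) (evalM-zeros xs)

evalM-*M : (a b x : Vec ℕ d) → evalM (a *M b) x ≡ evalM a x * evalM b x
evalM-*M []       []       []       = refl
evalM-*M (a ∷ as) (b ∷ bs) (x ∷ xs) = begin
  x ^ (a + b) * evalM (as *M bs) xs
    ≡⟨ cong₂ _*_ (ℕ.^-distribˡ-+-* x a b) (evalM-*M as bs xs) ⟩
  (x ^ a * x ^ b) * (evalM as xs * evalM bs xs)
    ≡⟨ ℕ*.interchange (x ^ a) (x ^ b) (evalM as xs) (evalM bs xs) ⟩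
  (x ^ a * evalM as xs) * (x ^ b * evalM bs xs) ∎
  where open ≡-Reasoning

evalM-unitVec : (i : Fin d) (x : Vec ℕ d) → evalM (unitVec i) x ≡ lookup x i
evalM-unitVec zero    (x ∷ xs) = begin
  x * 1 * evalM (replicate _ 0) xs  ≡⟨ cong (x * 1 *_) (evalM-zeros xs) ⟩
  x * 1 * 1                         ≡⟨ ℕ.*-identityʳ (x * 1) ⟩
  x * 1                             ≡⟨ ℕ.*-identityʳ x ⟩
  x                                 ∎
  where open ≡-Reasoning
evalM-unitVec (suc i) (x ∷ xs) = trans (ℕ.+-identityʳ (evalM (unitVec i) xs)) (evalM-unitVec i xs)

evalM-^P-≤ : (x : Vec ℕ n) {P : AbsPoly n} {c : ℕ} → (∀ {u} → u ∈ P → evalM u x ≤ c) →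
             ∀ e {m} → m ∈ P ^P e → evalM m x ≤ c ^ e
evalM-^P-≤ x P≤c zero    (here refl) = ℕ.≤-reflexive (evalM-zeros x)
evalM-^P-≤ x {P} P≤c (suc e) m∈ with ∈-*P⁻ P (P ^P e) m∈
... | u , v , u∈P , v∈ , refl rewrite evalM-*M u v x =
  ℕ.*-mono-≤ (P≤c u∈P) (evalM-^P-≤ x P≤c e v∈)

evalM-substM-≤ : (x : Vec ℕ n) {r : Vec (AbsPoly n) d} {y : Vec ℕ d} →
                 (∀ j {u} → u ∈ lookup r j → evalM u x ≤ lookup y j) →
                 ∀ e {m} → m ∈ substM e r → evalM m x ≤ evalM e y
evalM-substM-≤ x {[]}    {[]}    r≤y []       (here refl) = ℕ.≤-reflexive (evalM-zeros x)
evalM-substM-≤ x {q ∷ r} {y ∷ ys} r≤y (e ∷ es) m∈ with ∈-*P⁻ (q ^P e) (substM es r) m∈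
... | u , v , u∈ , v∈ , refl rewrite evalM-*M u v x =
  ℕ.*-mono-≤ (evalM-^P-≤ x (r≤y zero) e u∈) (evalM-substM-≤ x (λ j → r≤y (suc j)) es v∈)

∈⇒≤-sum-map : {A : Set} (f : A → ℕ) {a : A} {xs : List A} → a ∈ xs → f a ≤ sum (map f xs)
∈⇒≤-sum-map f (here refl)              = ℕ.m≤m+n (f _) _
∈⇒≤-sum-map f {xs = x ∷ _} (there a∈) = ℕ.≤-trans (∈⇒≤-sum-map f a∈) (ℕ.m≤n+m _ (f x))

evalM-≤-evalP : (x : Vec ℕ n) {P : AbsPoly n} {m : Monomial n} → m ∈ P → evalM m x ≤ evalP P x
evalM-≤-evalP x m∈P = ∈⇒≤-sum-map (λ m → evalM m x) (∈-deduplicate⁺ _≟M_ m∈P)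

infix 4 _≼_
_≼_ : AMP n → (Vec ℕ n → Vec ℕ n) → Set
q ≼ f = ∀ x i {m} → m ∈ lookup q i → evalM m x ≤ lookup (f x) i

IdA-≼-id : IdA {n} ≼ (λ x → x)
IdA-≼-id x i m∈ rewrite lookup-IdA i with m∈
... | here refl rewrite unitM≡unitVec i = ℕ.≤-reflexive (evalM-unitVec i x)

≼-evalA : (p : AMP n) → p ≼ evalA p
≼-evalA p x i m∈ rewrite Vecₚ.lookup∘tabulate (λ i → evalP (lookup p i) x) i = evalM-≤-evalP x m∈

∘A-≼ : {p q : AMP n} {f g : Vec ℕ n → Vec ℕ n} → p ≼ f → q ≼ g → (p ∘A q) ≼ (λ x → f (g x))
∘A-≼ {p = p} {q} {g = g} p≼f q≼g x i m∈ rewrite lookup-∘A p q i with ∈-substP⁻ (lookup p i) q m∈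
... | a , a∈ , m∈qa = ℕ.≤-trans (evalM-substM-≤ x (q≼g x) a m∈qa) (p≼f (g x) i a∈)

evalSeq-++ : (ps qs : List (AMP n)) (x : Vec ℕ n) →
             evalSeq (ps ++ qs) x ≡ evalSeq qs (evalSeq ps x)
evalSeq-++ []       qs x = refl
evalSeq-++ (p ∷ ps) qs x = evalSeq-++ ps qs (evalA p x)

cl-≼-run : {S : SDL n} {q : AMP n} → cl S q → ∃ λ ps → All (_∈ S) ps × q ≼ evalSeq ps
cl-≼-run cl-id                = [] , [] , IdA-≼-id
cl-≼-run (cl-base {p} p∈S)    = [ p ] , p∈S ∷ [] , ≼-evalA p
cl-≼-run (cl-comp {p} {q} cp cq) with cl-≼-run cp | cl-≼-run cq
... | ps , ps∈S , p≼ps | qs , qs∈S , q≼qs =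
  qs ++ ps , All.++⁺ qs∈S ps∈S ,
  λ x i {m} m∈ → subst (λ y → evalM m x ≤ lookup y i) (sym (evalSeq-++ qs ps x))
                         (∘A-≼ {p = p} {q} {evalSeq ps} {evalSeq qs} p≼ps q≼qs x i m∈)

-- The degree bound

lookup-≤-sum : (xs : Vec ℕ d) (i : Fin d) → lookup xs i ≤ Vec.sum xs
lookup-≤-sum (x ∷ xs) zero    = ℕ.m≤m+n x (Vec.sum xs)
lookup-≤-sum (x ∷ xs) (suc i) = ℕ.≤-trans (lookup-≤-sum xs i) (ℕ.m≤n+m (Vec.sum xs) x)

evalM-replicate : (m : Vec ℕ d) (N : ℕ) → evalM m (replicate d N) ≡ N ^ Vec.sum m
evalM-replicate []      N = refl
evalM-replicate (e ∷ m) N =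
  trans (cong (N ^ e *_) (evalM-replicate m N)) (sym (ℕ.^-distribˡ-+-* N e (Vec.sum m)))

evalM-≤-^ : {y : Vec ℕ d} {N : ℕ} → (∀ j → lookup y j ≤ N) → ∀ e → evalM e y ≤ N ^ Vec.sum e
evalM-≤-^ {y = []}    y≤N []       = ℕ.≤-refl
evalM-≤-^ {y = _ ∷ _} {N} y≤N (e ∷ es) =
  subst (_ ≤_) (sym (ℕ.^-distribˡ-+-* N e (Vec.sum es)))
        (ℕ.*-mono-≤ (ℕ.^-monoˡ-≤ e (y≤N zero)) (evalM-≤-^ (λ j → y≤N (suc j)) es))

coeffSum : Poly d → ℕ
coeffSum b = sum (map proj₁ b)

degreeSum : Poly d → ℕ
degreeSum b = sum (map (λ (_ , e) → Vec.sum e) b)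

evalPoly-≤ : (b : Poly d) {y : Vec ℕ d} {N D : ℕ} → (∀ j → lookup y j ≤ suc N) →
             degreeSum b ≤ D → evalPoly b y ≤ coeffSum b * suc N ^ D
evalPoly-≤ []            y≤N b≤D = z≤n
evalPoly-≤ ((c , e) ∷ b) {y} {N} {D} y≤N b≤D = begin
  c * evalM e y + evalPoly b y
    ≤⟨ ℕ.+-mono-≤ (ℕ.*-monoʳ-≤ c evalM≤) (evalPoly-≤ b y≤N (ℕ.m+n≤o⇒n≤o (Vec.sum e) b≤D)) ⟩
  c * suc N ^ D + coeffSum b * suc N ^ D
    ≡⟨ ℕ.*-distribʳ-+ (suc N ^ D) c (coeffSum b) ⟨
  (c + coeffSum b) * suc N ^ D ∎
  where
  open ℕ.≤-Reasoning
  evalM≤ : evalM e y ≤ suc N ^ D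
  evalM≤ = ℕ.≤-trans (evalM-≤-^ y≤N e) (ℕ.^-monoʳ-≤ (suc N) (ℕ.m+n≤o⇒m≤o (Vec.sum e) b≤D))

^≤*^⇒≤ : {C N k D : ℕ} → C < suc N → suc N ^ k ≤ C * suc N ^ D → k ≤ D
^≤*^⇒≤ {C} {N} {k} {D} C<N Nᵏ≤CNᴰ with k ℕ.≤? D
... | yes k≤D = k≤D
... | no  k≰D = contradiction (begin
  suc N ^ suc D   ≤⟨ ℕ.^-monoʳ-≤ (suc N) (ℕ.≰⇒> k≰D) ⟩
  suc N ^ k       ≤⟨ Nᵏ≤CNᴰ ⟩
  C * suc N ^ D   ∎) (ℕ.<⇒≱ (ℕ.*-monoˡ-< (suc N ^ D) {{ℕ.m^n≢0 (suc N) D}} C<N))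
  where open ℕ.≤-Reasoning

lookup-snoc-replicate-≤ : {N L : ℕ} → L ≤ N → ∀ j → lookup (snoc (replicate n N) L) j ≤ N
lookup-snoc-replicate-≤ {zero}  L≤N zero    = L≤N
lookup-snoc-replicate-≤ {suc n} L≤N zero    = ℕ.≤-refl
lookup-snoc-replicate-≤ {suc n} L≤N (suc j) = lookup-snoc-replicate-≤ {n} L≤N j

cl-degree-≤ : {S : SDL n} (bounded : PolyBounded S) {q : AMP n} → cl S q →
              ∀ i {m} → m ∈ lookup q i → Vec.sum m ≤ degreeSum (lookup (proj₁ bounded) i)
cl-degree-≤ {n} (b , bounds) q∈cl i {m} m∈ with cl-≼-run q∈cl
... | ps , ps∈S , q≼ps = ^≤*^⇒≤ (s≤s (ℕ.m≤m+n C L)) (begin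
  suc N ^ Vec.sum m                 ≡⟨ evalM-replicate m (suc N) ⟨
  evalM m x                         ≤⟨ q≼ps x i m∈ ⟩
  lookup (evalSeq ps x) i           ≤⟨ bounds x ps ps∈S i ⟩
  evalPoly (lookup b i) (snoc x L)  ≤⟨ evalPoly-≤ (lookup b i) (lookup-snoc-replicate-≤ L≤N) ℕ.≤-refl ⟩
  C * suc N ^ D                     ∎)
  where
  open ℕ.≤-Reasoning
  C = coeffSum (lookup b i)
  D = degreeSum (lookup b i)
  L = length ps
  N = C + L
  x = replicate n (suc N)
  L≤N : L ≤ suc N
  L≤N = ℕ.m≤n⇒m≤1+n (ℕ.m≤n+m L C)

Supported : List (Monomial n) → AMP n → Set
Supported L p = ∀ i → lookup p i ⊆ L

vecsOver : {A : Set} → List A → (d : ℕ) → List (Vec A d)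
vecsOver xs zero    = [ [] ]
vecsOver xs (suc d) = cartesianProductWith _∷_ xs (vecsOver xs d)

∈-vecsOver : {A : Set} {xs : List A} (v : Vec A d) → (∀ j → lookup v j ∈ xs) → v ∈ vecsOver xs d
∈-vecsOver []      _      = here refl
∈-vecsOver (x ∷ v) v⊆xs =
  ∈-cartesianProductWith⁺ _∷_ (v⊆xs zero) (∈-vecsOver v (v⊆xs ∘ suc))

sum≤⇒∈-vecsOver-upTo : {D : ℕ} (m : Vec ℕ d) → Vec.sum m ≤ D → m ∈ vecsOver (upTo (suc D)) d
sum≤⇒∈-vecsOver-upTo m m≤D =
  ∈-vecsOver m (λ j → ∈-upTo⁺ (s≤s (ℕ.≤-trans (lookup-≤-sum m j) m≤D)))

cl-finitelySupported : {S : SDL n} → PolyBounded S → ∃ λ L → ∀ {q} → cl S q → Supported L q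
cl-finitelySupported {n} bounded@(b , _) =
  vecsOver (upTo (suc D)) n ,
  λ q∈cl i {m} m∈ → sum≤⇒∈-vecsOver-upTo m (ℕ.≤-trans (cl-degree-≤ bounded q∈cl i m∈) (D-bound i))
  where
  D = Vec.sum (Vec.map degreeSum b)
  D-bound : ∀ i → degreeSum (lookup b i) ≤ D
  D-bound i = subst (_≤ D) (Vecₚ.lookup-map i degreeSum b) (lookup-≤-sum (Vec.map degreeSum b) i)

-- Pigeonhole on the powers of p

module _ {n : ℕ} where
  open import Data.List.Membership.DecPropositional (_≟M_ {n}) using (_∈?_)

  membershipBit : Monomial n → AbsPoly n → Fin 2
  membershipBit u P with u ∈? P
  ... | yes _ = suc zero
  ... | no  _ = zero

  membershipBit-≡ : (u : Monomial n) (P Q : AbsPoly n) →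
                    membershipBit u P ≡ membershipBit u Q → u ∈ P → u ∈ Q
  membershipBit-≡ u P Q same u∈P with u ∈? P | u ∈? Q
  ... | _       | yes u∈Q = u∈Q
  ... | no  u∉P | no  _   = contradiction u∈P u∉P
  ... | yes _   | no  _   with () ← same

encode : (L : List (Monomial n)) → AbsPoly n → Fin (2 ^ length L)
encode []      P = zero
encode (u ∷ L) P = combine (membershipBit u P) (encode L P)

encode-≡ : (L : List (Monomial n)) {P Q : AbsPoly n} → encode L P ≡ encode L Q →
           ∀ {u} → u ∈ L → u ∈ P → u ∈ Q
encode-≡ (v ∷ L) {P} {Q} same u∈vL
  with bit≡ , rest≡ ← combine-injective (membershipBit v P) (encode L P)
                                        (membershipBit v Q) (encode L Q) same
  with u∈vL
... | here refl = membershipBit-≡ v P Q bit≡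
... | there u∈L = encode-≡ L {P} {Q} rest≡ u∈L

encodeV : (L : List (Monomial n)) → Vec (AbsPoly n) d → Fin ((2 ^ length L) ^ d)
encodeV L []       = zero
encodeV L (P ∷ Ps) = combine (encode L P) (encodeV L Ps)

encodeV-≡ : (L : List (Monomial n)) {ps qs : Vec (AbsPoly n) d} → encodeV L ps ≡ encodeV L qs →
            ∀ i {u} → u ∈ L → u ∈ lookup ps i → u ∈ lookup qs i
encodeV-≡ L {P ∷ ps} {Q ∷ qs} same i
  with head≡ , tail≡ ← combine-injective (encode L P) (encodeV L ps) (encode L Q) (encodeV L qs) same
  with i
... | zero  = encode-≡ L {P} {Q} head≡
... | suc i = encodeV-≡ L {ps} {qs} tail≡ i

encodeV-injective : (L : List (Monomial n)) (p q : AMP n) → Supported L p → Supported L q →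
                    encodeV L p ≡ encodeV L q → p ≈ q
encodeV-injective L p q p⊆L q⊆L same i =
  ⊆⊇⇒≈P (λ u∈ → encodeV-≡ L {p} {q} same i (p⊆L i u∈) u∈)
        (λ u∈ → encodeV-≡ L {q} {p} (sym same) i (q⊆L i u∈) u∈)

supported-powers⇒eventuallyPeriodic : (L : List (Monomial n)) (p : AMP n) →
                                      (∀ t → Supported L (p ^⟨ t ⟩)) → EventuallyPeriodic p
supported-powers⇒eventuallyPeriodic L p supported
  with i , j , i<j , same ← pigeonhole (ℕ.n<1+n _) (λ t → encodeV L (p ^⟨ toℕ t ⟩))
  with c , i+1+c≡j ← ℕ.m≤n⇒∃[o]m+o≡n i<j
  = toℕ i , c , (begin
    p ^⟨ toℕ i ⟩
      ≈⟨ encodeV-injective L (p ^⟨ toℕ i ⟩) (p ^⟨ toℕ j ⟩)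
                           (supported (toℕ i)) (supported (toℕ j)) same ⟩
    p ^⟨ toℕ j ⟩
      ≡⟨ cong (p ^⟨_⟩) (trans (sym i+1+c≡j) (cong suc (ℕ.+-comm (toℕ i) c))) ⟩
    p ^⟨ suc c + toℕ i ⟩ ∎)
  where open ≈-Reasoning

^⟨⟩-cl : {S : SDL n} {p : AMP n} → cl S p → ∀ t → cl S (p ^⟨ t ⟩)
^⟨⟩-cl p∈cl zero    = cl-id
^⟨⟩-cl p∈cl (suc t) = cl-comp p∈cl (^⟨⟩-cl p∈cl t)

lemmaA6 : ∀ (n : ℕ) (S : SDL n) → PolyBounded S → ∀ (p : AMP n) → cl S p →
          Σ ℕ (λ k → (k > 0) × Idempotent (p ^⟨ k ⟩))
lemmaA6 n S bounded p p∈cl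
  with L , cl⊆L ← cl-finitelySupported bounded
  with a , c , periodic ← supported-powers⇒eventuallyPeriodic L p (λ t → cl⊆L (^⟨⟩-cl p∈cl t))
  = suc a * suc c , s≤s z≤n , idempotent-^⟨⟩ p {a} {c} periodic
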